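{- Let $k\in\{1,2,3,4\}$, let $G=\{(A_1,X_1),\dots,(A_n,X_n)\}$ and $(B,Y)$ be I/O pairs. Then $G\vdash_{OUT_k^+}(B,Y)$ iff the classical propositional formula $\neg T^k_n(B,Y)\wedge\bigwedge_{(A,X)\in G}T^k_n(A,X)$ is unsatisfiable, where, with $N=1$ for $k\in\{2,4\}$ and $N=n+1$ for $k\in\{1,3\}$: $T^k_n(A,X)=\big(\bigwedge_{l=1}^{N}A^l\big)\to X^0$ for $k\in\{1,2\}$, and $T^k_n(A,X)=\big(\bigwedge_{l=1}^{N}A^l\big)\to\big(\bigwedge_{l=0}^{N}X^l\big)$ for $k\in\{3,4\}$.
   Context: Formulas are classical propositional formulas built with $\top,\bot,\neg,\wedge,\vee,\to$; $\models$ denotes classical semantic entailment. An I/O pair is an ordered pair $(A,X)$ of formulas. Rules on pairs: (TOP) $(\top,\top)$ from no premises; (BOT) $(\bot,\bot)$ from no premises; (WO) from $(A,X)$ derive $(A,Y)$ whenever $X\models Y$; (SI) from $(A,X)$ derive $(B,X)$ whenever $B\models A$; (AND) from $(A,X_1)$ and $(A,X_2)$ derive $(A,X_1\wedge X_2)$; (OR) from $(A_1,X)$ and $(A_2,X)$ derive $(A_1\vee A_2,X)$; (CT) from $(A,X)$ and $(A\wedge X,Y)$ derive $(A,Y)$. $OUT_1^+$ = {TOP, BOT, WO, SI, AND}; $OUT_2^+$ = $OUT_1^+$ + OR; $OUT_3^+$ = $OUT_1^+$ + CT; $OUT_4^+$ = $OUT_1^+$ + OR + CT. $G\vdash_{L}(B,Y)$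 means there is a finite tree with root $(B,Y)$, each leaf an element of $G$ or an axiom of $L$, and each non-leaf node obtained from its children by a rule of $L$. Let $\mathcal{V}$ be the set of propositional variables occurring in $G$ or $(B,Y)$. For each $x\in\mathcal{V}$ and $l\in\{0,\dots,N\}$ let $x^l$ be a fresh distinct variable; for a formula $A$ over $\mathcal{V}$, $A^l$ is the formula obtained by replacing every variable $x$ by $x^l$. -}

module Defs where

open import Data.Nat using (ℕ; zero; suc; _+_)
open import Data.Bool using (Bool; true; false; not; _∧_; _∨_)
open import Data.Product using (_×_; _,_)
open import Data.Sum using (_⊎_)
open import Data.List using (List; length; foldr)
open import Data.List.Membership.Propositional using (_∈_)
open import Relation.Binary.PropositionalEquality using (_≡_)

data Fm (V : Set) : Set where
  var  : V → Fm V
  ⊤'   : Fm V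
  ⊥'   : Fm V
  ¬'_  : Fm V → Fm V
  _∧'_ : Fm V → Fm V → Fm V
  _∨'_ : Fm V → Fm V → Fm V
  _→'_ : Fm V → Fm V → Fm V

infixr 6 _∧'_
infixr 5 _∨'_
infixr 4 _→'_

⟦_⟧ : {V : Set} → Fm V → (V → Bool) → Bool
⟦ var x ⟧ v = v x
⟦ ⊤' ⟧ v = true
⟦ ⊥' ⟧ v = false
⟦ ¬' A ⟧ v = not (⟦ A ⟧ v)
⟦ A ∧' B ⟧ v = ⟦ A ⟧ v ∧ ⟦ B ⟧ v
⟦ A ∨' B ⟧ v = ⟦ A ⟧ v ∨ ⟦ B ⟧ v
⟦ A →' B ⟧ v = not (⟦ A ⟧ v) ∨ ⟦ B ⟧ v

Var : Set
Var = ℕ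

Form : Set
Form = Fm Var

_⊨_ : Form → Form → Set
A ⊨ B = (v : Var → Bool) → ⟦ A ⟧ v ≡ true → ⟦ B ⟧ v ≡ true

IOPair : Set
IOPair = Form × Form

HasOR : ℕ → Set
HasOR k = k ≡ 2 ⊎ k ≡ 4

HasCT : ℕ → Set
HasCT k = k ≡ 3 ⊎ k ≡ 4

data _⊢[_]_ (G : List IOPair) (k : ℕ) : IOPair → Set where
  leaf : ∀ {p} → p ∈ G → G ⊢[ k ] p
  TOP  : G ⊢[ k ] (⊤' , ⊤')
  BOT  : G ⊢[ k ] (⊥' , ⊥')
  WO   : ∀ {A X Y} → G ⊢[ k ] (A , X) → X ⊨ Y → G ⊢[ k ] (A , Y)
  SI   : ∀ {A B X} → G ⊢[ k ] (A , X) → B ⊨ A → G ⊢[ k ] (B , X)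
  AND  : ∀ {A X₁ X₂} → G ⊢[ k ] (A , X₁) → G ⊢[ k ] (A , X₂)
       → G ⊢[ k ] (A , X₁ ∧' X₂)
  OR   : ∀ {A₁ A₂ X} → HasOR k → G ⊢[ k ] (A₁ , X) → G ⊢[ k ] (A₂ , X)
       → G ⊢[ k ] (A₁ ∨' A₂ , X)
  CT   : ∀ {A X Y} → HasCT k → G ⊢[ k ] (A , X) → G ⊢[ k ] (A ∧' X , Y)
       → G ⊢[ k ] (A , Y)

-- Indexed copies: x^l is the fresh variable (x , l) of type Var × ℕ.
-- All x^l are pairwise distinct and distinct from nothing else in use.
Form₂ : Set
Form₂ = Fm (Var × ℕ)

copy : Form → ℕ → Form₂
copy (var x) l = var (x , l)
copy ⊤' l = ⊤'
copy ⊥' l = ⊥'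
copy (¬' A) l = ¬' copy A l
copy (A ∧' B) l = copy A l ∧' copy B l
copy (A ∨' B) l = copy A l ∨' copy B l
copy (A →' B) l = copy A l →' copy B l

conjFrom : ℕ → ℕ → (ℕ → Form₂) → Form₂
conjFrom a zero f = ⊤'
conjFrom a (suc c) f = f a ∧' conjFrom (suc a) c f

bigN : ℕ → ℕ → ℕ
bigN 2 n = 1
bigN 4 n = 1
bigN k n = suc n

T : ℕ → ℕ → IOPair → Form₂
T 3 n (A , X) = conjFrom 1 (bigN 3 n) (copy A) →' conjFrom 0 (suc (bigN 3 n)) (copy X)
T 4 n (A , X) = conjFrom 1 (bigN 4 n) (copy A) →' conjFrom 0 (suc (bigN 4 n)) (copy X)
T k n (A , X) = conjFrom 1 (bigN k n) (copy A) →' copy X 0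

translation : ℕ → List IOPair → IOPair → Form₂
translation k G BY =
  ¬' T k (length G) BY ∧' foldr (λ p acc → T k (length G) p ∧' acc) ⊤' G

Unsatisfiable : Form₂ → Set
Unsatisfiable φ = (v : Var × ℕ → Bool) → ⟦ φ ⟧ v ≡ false

-- Soundness: read a valuation of the indexed variables as a family of valuations, level l
-- interpreting the copies x^l. Then T^k_n(A,X) says that X holds at the output levels (0, or
-- 0..N when k ∈ {3,4}) whenever A holds at all input levels 1..N, and this property survives
-- every rule of OUT_k^+: OR because N = 1 when OR is available, CT because then every input
-- level is an output level.
-- Completeness: collect into D the outputs of the pairs of G whose inputs follow from B (from
-- B ∧ D, repeated until nothing new fires, when CT is available). Either D ⊨ Y and (B,Y) is
-- derivable, or a valuation of D ∧ ¬Y at level 0, together with models of B (of B ∧ D under CT)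
-- at the input levels that falsify the remaining inputs, satisfies the translation. Without OR
-- the n pairs may need n different falsifying levels; with OR, B is first split into cells that
-- decide every input of G, and a single model of a cell falsifies all of them at level 1.

module Submission where

open import Defs
open import Data.Nat using (ℕ; zero; suc; _+_; _<_; _≤_; s≤s; z<s; _≟_)
open import Data.Nat.Properties using (+-identityʳ; +-suc; ≤-reflexive; m<n⇒m<1+n)
open import Data.Nat.Induction using (<-wellFounded)
open import Data.Bool using (Bool; true; false; not; _∧_; _∨_)
open import Data.Bool.Properties using (¬-not; not-¬; ∨-inverseʳ)
open import Data.List using (List; []; _∷_; length; foldr; map; _++_)
open import Data.List.Properties using (length-removeAt′)
open import Data.List.Relation.Unary.All as All using (All; []; _∷_)
open import Data.List.Relation.Unary.All.Properties using (¬Any⇒All¬; ─⁺; map⁻)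
open import Data.List.Relation.Unary.Any as Any using (Any; here; there; any?; _─_)
open import Data.List.Membership.Propositional using (_∈_)
open import Data.List.Membership.Propositional.Properties using (∈-++⁺ˡ; ∈-++⁺ʳ)
open import Data.Product using (∃; _×_; _,_; proj₁; proj₂)
open import Data.Sum as Sum using (_⊎_; inj₁; inj₂; [_,_]′)
open import Data.Empty using (⊥-elim)
open import Function using (_∘_; id)
open import Function.Bundles using (_⇔_; mk⇔; Equivalence)
import Function.Properties.Equivalence as ⇔
open import Function.Related.TypeIsomorphisms using (→-cong-⇔)
open import Induction.WellFounded using (Acc; acc)
open import Relation.Nullary using (¬_; Dec; yes; no; contradiction)
open import Relation.Binary.PropositionalEquality using (_≡_; refl; sym; trans; cong; cong₂; subst)

open Equivalence using (to; from)

Valuation : Set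
Valuation = Var → Bool

Valuation₂ : Set
Valuation₂ = Var × ℕ → Bool

∧-true⁺ : ∀ {x y} → x ≡ true → y ≡ true → x ∧ y ≡ true
∧-true⁺ refl refl = refl

∧-trueˡ : ∀ {x y} → x ∧ y ≡ true → x ≡ true
∧-trueˡ {true} _ = refl
∧-trueˡ {false} ()

∧-trueʳ : ∀ {x y} → x ∧ y ≡ true → y ≡ true
∧-trueʳ {true} p = p
∧-trueʳ {false} ()

∨-true⁻ : ∀ {x y} → x ∨ y ≡ true → x ≡ true ⊎ y ≡ true
∨-true⁻ {true} _ = inj₁ refl
∨-true⁻ {false} p = inj₂ p

not-true : ∀ {x} → not x ≡ true → x ≡ false
not-true {false} _ = refl
not-true {true} ()

⇒-true : ∀ x y → not x ∨ y ≡ true ⇔ (x ≡ true → y ≡ true)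
⇒-true true y = mk⇔ (λ p _ → p) (λ f → f refl)
⇒-true false y = mk⇔ (λ _ ()) (λ _ → refl)

-- Deciding entailment by truth tables

vars : Form → List Var
vars (var x) = x ∷ []
vars ⊤' = []
vars ⊥' = []
vars (¬' A) = vars A
vars (A ∧' B) = vars A ++ vars B
vars (A ∨' B) = vars A ++ vars B
vars (A →' B) = vars A ++ vars B

Agree : List Var → Valuation → Valuation → Set
Agree xs v w = ∀ {x} → x ∈ xs → v x ≡ w x

⟦⟧-coincidence : ∀ A {v w} → Agree (vars A) v w → ⟦ A ⟧ v ≡ ⟦ A ⟧ w
⟦⟧-coincidence (var x) agree = agree (here refl)
⟦⟧-coincidence ⊤' agree = refl
⟦⟧-coincidence ⊥' agree = refl
⟦⟧-coincidence (¬' A) agree = cong not (⟦⟧-coincidence A agree)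
⟦⟧-coincidence (A ∧' B) agree =
  cong₂ _∧_ (⟦⟧-coincidence A (agree ∘ ∈-++⁺ˡ)) (⟦⟧-coincidence B (agree ∘ ∈-++⁺ʳ (vars A)))
⟦⟧-coincidence (A ∨' B) agree =
  cong₂ _∨_ (⟦⟧-coincidence A (agree ∘ ∈-++⁺ˡ)) (⟦⟧-coincidence B (agree ∘ ∈-++⁺ʳ (vars A)))
⟦⟧-coincidence (A →' B) agree =
  cong₂ (λ a b → not a ∨ b) (⟦⟧-coincidence A (agree ∘ ∈-++⁺ˡ))
                            (⟦⟧-coincidence B (agree ∘ ∈-++⁺ʳ (vars A)))

DependsOnlyOn : List Var → (Valuation → Bool) → Set
DependsOnlyOn xs P = ∀ {v w} → Agree xs v w → P v ≡ P w

_[_≔_] : Valuation → Var → Bool → Valuation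
(v [ x ≔ b ]) y with y ≟ x
... | yes _ = b
... | no _ = v y

[≔]-self : ∀ v x y → (v [ x ≔ v x ]) y ≡ v y
[≔]-self v x y with y ≟ x
... | yes refl = refl
... | no _ = refl

[≔]-agree : ∀ {xs v w} x b → Agree xs v w → Agree (x ∷ xs) (v [ x ≔ b ]) (w [ x ≔ b ])
[≔]-agree x b agree {y} y∈ with y ≟ x | y∈
... | yes _ | _ = refl
... | no y≢x | here y≡x = contradiction y≡x y≢x
... | no _ | there y∈xs = agree y∈xs

search : ∀ xs (P : Valuation → Bool) → DependsOnlyOn xs P
       → (∃ λ v → P v ≡ true) ⊎ (∀ v → P v ≡ false)
search [] P dep with P (λ _ → false) in eq
... | true = inj₁ (_ , eq)
... | false = inj₂ λ v → trans (dep λ ()) eq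
search (x ∷ xs) P dep
  with search xs (λ v → P (v [ x ≔ true ])) (dep ∘ [≔]-agree x true)
     | search xs (λ v → P (v [ x ≔ false ])) (dep ∘ [≔]-agree x false)
... | inj₁ (_ , Pv) | _ = inj₁ (_ , Pv)
... | inj₂ _ | inj₁ (_ , Pv) = inj₁ (_ , Pv)
... | inj₂ none₁ | inj₂ none₀ = inj₂ λ v → trans (dep λ {y} _ → sym ([≔]-self v x y)) (both v (v x))
  where
  both : ∀ v b → P (v [ x ≔ b ]) ≡ false
  both v true = none₁ v
  both v false = none₀ v

sat? : (A : Form) → (∃ λ v → ⟦ A ⟧ v ≡ true) ⊎ A ⊨ ⊥'
sat? A with search (vars A) ⟦ A ⟧ (⟦⟧-coincidence A)
... | inj₁ model = inj₁ model
... | inj₂ none = inj₂ λ v A-true → trans (sym (none v)) A-true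

_⊭_ : Form → Form → Set
A ⊭ B = ∃ λ w → ⟦ A ⟧ w ≡ true × ⟦ B ⟧ w ≡ false

entails-or-refutes : ∀ A B → A ⊨ B ⊎ A ⊭ B
entails-or-refutes A B with sat? (A ∧' ¬' B)
... | inj₁ (w , t) = inj₂ (w , ∧-trueˡ t , not-true (∧-trueʳ t))
... | inj₂ unsat = inj₁ λ v a → ¬-not λ b → contradiction (unsat v (∧-true⁺ a (cong not b))) λ ()

_⊨?_ : (A B : Form) → Dec (A ⊨ B)
A ⊨? B with entails-or-refutes A B
... | inj₁ A⊨B = yes A⊨B
... | inj₂ (w , a , b) = no λ A⊨B → not-¬ (A⊨B w a) b

⊢-⊤ : ∀ {G k A} → G ⊢[ k ] (A , ⊤')
⊢-⊤ = SI TOP λ _ _ → refl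

⊢-explode : ∀ {G k A Y} → A ⊨ ⊥' → G ⊢[ k ] (A , Y)
⊢-explode A⊨⊥ = WO (SI BOT A⊨⊥) λ _ ()

record Closed (k : ℕ) (P : IOPair → Set) : Set where
  field
    top : P (⊤' , ⊤')
    bot : P (⊥' , ⊥')
    wo  : ∀ {A X Y} → P (A , X) → X ⊨ Y → P (A , Y)
    si  : ∀ {A B X} → P (A , X) → B ⊨ A → P (B , X)
    and : ∀ {A X₁ X₂} → P (A , X₁) → P (A , X₂) → P (A , X₁ ∧' X₂)
    or  : ∀ {A₁ A₂ X} → HasOR k → P (A₁ , X) → P (A₂ , X) → P (A₁ ∨' A₂ , X)
    ct  : ∀ {A X Y} → HasCT k → P (A , X) → P (A ∧' X , Y) → P (A , Y)

module _ {k P} (closed : Closed k P) where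
  open Closed closed

  ⊢-sound : ∀ {G p} → All P G → G ⊢[ k ] p → P p
  ⊢-sound PG (leaf p∈G) = All.lookup PG p∈G
  ⊢-sound PG TOP = top
  ⊢-sound PG BOT = bot
  ⊢-sound PG (WO d X⊨Y) = wo (⊢-sound PG d) X⊨Y
  ⊢-sound PG (SI d B⊨A) = si (⊢-sound PG d) B⊨A
  ⊢-sound PG (AND d₁ d₂) = and (⊢-sound PG d₁) (⊢-sound PG d₂)
  ⊢-sound PG (OR o d₁ d₂) = or o (⊢-sound PG d₁) (⊢-sound PG d₂)
  ⊢-sound PG (CT c d₁ d₂) = ct c (⊢-sound PG d₁) (⊢-sound PG d₂)

-- Levelwise semantics of the translation

_at_ : Valuation₂ → ℕ → Valuation
(v at l) x = v (x , l)

stack : (ℕ → Valuation) → Valuation₂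
stack vs (x , l) = vs l x

⟦copy⟧ : ∀ A l v → ⟦ copy A l ⟧ v ≡ ⟦ A ⟧ (v at l)
⟦copy⟧ (var x) l v = refl
⟦copy⟧ ⊤' l v = refl
⟦copy⟧ ⊥' l v = refl
⟦copy⟧ (¬' A) l v = cong not (⟦copy⟧ A l v)
⟦copy⟧ (A ∧' B) l v = cong₂ _∧_ (⟦copy⟧ A l v) (⟦copy⟧ B l v)
⟦copy⟧ (A ∨' B) l v = cong₂ _∨_ (⟦copy⟧ A l v) (⟦copy⟧ B l v)
⟦copy⟧ (A →' B) l v = cong₂ (λ a b → not a ∨ b) (⟦copy⟧ A l v) (⟦copy⟧ B l v)

⟦conjFrom-copy⟧ : ∀ a c A v
  → ⟦ conjFrom a c (copy A) ⟧ v ≡ true ⇔ (∀ j → j < c → ⟦ A ⟧ (v at (a + j)) ≡ true)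
⟦conjFrom-copy⟧ a zero A v = mk⇔ (λ _ _ ()) (λ _ → refl)
⟦conjFrom-copy⟧ a (suc c) A v = mk⇔
  (λ t → λ { zero _ → level (sym (+-identityʳ a)) (trans (sym (⟦copy⟧ A a v)) (∧-trueˡ t))
           ; (suc j) (s≤s j<c) → level (sym (+-suc a j)) (to rest (∧-trueʳ t) j j<c) })
  (λ all → ∧-true⁺ (trans (⟦copy⟧ A a v) (level (+-identityʳ a) (all 0 z<s)))
                   (from rest λ j j<c → level (+-suc a j) (all (suc j) (s≤s j<c))))
  where
  rest : ⟦ conjFrom (suc a) c (copy A) ⟧ v ≡ true ⇔ (∀ j → j < c → ⟦ A ⟧ (v at suc (a + j)) ≡ true)
  rest = ⟦conjFrom-copy⟧ (suc a) c A v
  level : ∀ {l l′} → l ≡ l′ → ⟦ A ⟧ (v at l) ≡ true → ⟦ A ⟧ (v at l′) ≡ true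
  level = subst (λ l → ⟦ A ⟧ (v at l) ≡ true)

⟦⋀⟧ : ∀ {I : Set} {V : Set} (φ : I → Fm V) is v
  → ⟦ foldr (λ i acc → φ i ∧' acc) ⊤' is ⟧ v ≡ true ⇔ All (λ i → ⟦ φ i ⟧ v ≡ true) is
⟦⋀⟧ φ [] v = mk⇔ (λ _ → []) (λ _ → refl)
⟦⋀⟧ φ (i ∷ is) v = mk⇔
  (λ t → ∧-trueˡ t ∷ to (⟦⋀⟧ φ is v) (∧-trueʳ t))
  (λ { (φi ∷ φis) → ∧-true⁺ φi (from (⟦⋀⟧ φ is v) φis) })

Premise : ℕ → Form → Valuation₂ → Set
Premise N A v = ∀ j → j < N → ⟦ A ⟧ (v at suc j) ≡ true

-- T^k_n read levelwise (⟦T₁₂⟧, ⟦T₃₄⟧): L is {0} for k ∈ {1,2} and {0,…,N} for k ∈ {3,4}.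
Valid : (ℕ → Set) → ℕ → Valuation₂ → IOPair → Set
Valid L N v (A , X) = Premise N A v → ∀ l → L l → ⟦ X ⟧ (v at l) ≡ true

⟦T₁₂⟧ : ∀ N h v
  → ⟦ conjFrom 1 N (copy (proj₁ h)) →' copy (proj₂ h) 0 ⟧ v ≡ true ⇔ Valid (_≡ 0) N v h
⟦T₁₂⟧ N (A , X) v = ⇔.trans (⇒-true _ _) (→-cong-⇔ (⟦conjFrom-copy⟧ 1 N A v) output)
  where
  output : ⟦ copy X 0 ⟧ v ≡ true ⇔ (∀ l → l ≡ 0 → ⟦ X ⟧ (v at l) ≡ true)
  output = mk⇔ (λ t → λ { _ refl → trans (sym (⟦copy⟧ X 0 v)) t })
               (λ all → trans (⟦copy⟧ X 0 v) (all 0 refl))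

⟦T₃₄⟧ : ∀ N h v
  → ⟦ conjFrom 1 N (copy (proj₁ h)) →' conjFrom 0 (suc N) (copy (proj₂ h)) ⟧ v ≡ true
  ⇔ Valid (_< suc N) N v h
⟦T₃₄⟧ N (A , X) v =
  ⇔.trans (⇒-true _ _) (→-cong-⇔ (⟦conjFrom-copy⟧ 1 N A v) (⟦conjFrom-copy⟧ 0 (suc N) X v))

premise-∨ : ∀ A₁ A₂ {v} → Premise 1 (A₁ ∨' A₂) v → Premise 1 A₁ v ⊎ Premise 1 A₂ v
premise-∨ A₁ A₂ {v} p = Sum.map (single A₁) (single A₂) (∨-true⁻ (p 0 z<s))
  where
  single : ∀ A → ⟦ A ⟧ (v at 1) ≡ true → Premise 1 A v
  single A a zero _ = a
  single A a (suc _) (s≤s ())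

Valid-closed : ∀ {k L N v} → 0 < N → (HasOR k → N ≡ 1) → (HasCT k → ∀ j → j < N → L (suc j))
             → Closed k (Valid L N v)
Valid-closed {k} {L} {N} {v} N>0 or-ok ct-ok = record
  { top = λ _ _ _ → refl
  ; bot = λ premise → contradiction (premise 0 N>0) λ ()
  ; wo = λ valid X⊨Y premise l Ll → X⊨Y _ (valid premise l Ll)
  ; si = λ valid B⊨A premise → valid λ j j<N → B⊨A _ (premise j j<N)
  ; and = λ valid₁ valid₂ premise l Ll → ∧-true⁺ (valid₁ premise l Ll) (valid₂ premise l Ll)
  ; or = λ {A₁ A₂ X} → or-valid {A₁} {A₂} {X}
  ; ct = λ c valid₁ valid₂ premise →
         valid₂ λ j j<N → ∧-true⁺ (premise j j<N) (valid₁ premise (suc j) (ct-ok c j j<N))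
  }
  where
  or-valid : ∀ {A₁ A₂ X} → HasOR k
           → Valid L N v (A₁ , X) → Valid L N v (A₂ , X) → Valid L N v (A₁ ∨' A₂ , X)
  or-valid {A₁} {A₂} o valid₁ valid₂ premise with or-ok o
  ... | refl = [ valid₁ , valid₂ ]′ (premise-∨ A₁ A₂ {v} premise)

Countermodel : (Valuation₂ → IOPair → Set) → List IOPair → IOPair → Set
Countermodel Sem G BY = ∃ λ v → ¬ Sem v BY × All (Sem v) G

derivable⇔unsatisfiable : ∀ {k} G BY (Sem : Valuation₂ → IOPair → Set)
  → (∀ v h → ⟦ T k (length G) h ⟧ v ≡ true ⇔ Sem v h)
  → (∀ v → Closed k (Sem v))
  → G ⊢[ k ] BY ⊎ Countermodel Sem G BY
  → (G ⊢[ k ] BY) ⇔ Unsatisfiable (translation k G BY)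
derivable⇔unsatisfiable {k} G BY Sem T⇔Sem closed decided = mk⇔ sound complete
  where
  ⋀T : Form₂
  ⋀T = foldr (λ h acc → T k (length G) h ∧' acc) ⊤' G

  ⟦⋀T⟧ : ∀ v → ⟦ ⋀T ⟧ v ≡ true ⇔ All (λ h → ⟦ T k (length G) h ⟧ v ≡ true) G
  ⟦⋀T⟧ = ⟦⋀⟧ (T k (length G)) G

  sound : G ⊢[ k ] BY → Unsatisfiable (translation k G BY)
  sound d v = ¬-not λ t →
    let Sem-G : All (Sem v) G
        Sem-G = All.map (to (T⇔Sem v _)) (to (⟦⋀T⟧ v) (∧-trueʳ t))
    in not-¬ (from (T⇔Sem v BY) (⊢-sound (closed v) Sem-G d)) (not-true (∧-trueˡ t))

  complete : Unsatisfiable (translation k G BY) → G ⊢[ k ] BY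
  complete unsat = [ id , refuted ]′ decided
    where
    refuted : Countermodel Sem G BY → G ⊢[ k ] BY
    refuted (v , ¬Sem-BY , Sem-G) = ⊥-elim (not-¬ (∧-true⁺ ¬T-BY T-G) (unsat v))
      where
      ¬T-BY : not (⟦ T k (length G) BY ⟧ v) ≡ true
      ¬T-BY = cong not (¬-not (¬Sem-BY ∘ to (T⇔Sem v BY)))
      T-G : ⟦ ⋀T ⟧ v ≡ true
      T-G = from (⟦⋀T⟧ v) (All.map (from (T⇔Sem v _)) Sem-G)

-- Completeness

∈-─ : ∀ {A : Set} {P : A → Set} {x xs} (p : Any P xs) → x ∈ xs → x ≡ Any.lookup p ⊎ x ∈ (xs ─ p)
∈-─ (here _) (here refl) = inj₁ refl
∈-─ (here _) (there x∈xs) = inj₂ x∈xs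
∈-─ (there _) (here refl) = inj₂ (here refl)
∈-─ (there p) (there x∈xs) = Sum.map₂ there (∈-─ p x∈xs)

module _ {G : List IOPair} {k : ℕ} where

  closure : (E : Form) (S : List IOPair) → All (G ⊢[ k ]_) S
          → ∃ λ D → G ⊢[ k ] (E , D) × All (λ h → D ⊨ proj₂ h ⊎ ¬ (E ⊨ proj₁ h)) S
  closure E [] [] = ⊤' , ⊢-⊤ , []
  closure E ((A , X) ∷ S) (d-AX ∷ ds) with closure E S ds | E ⊨? A
  ... | D , d , cls | yes E⊨A =
    X ∧' D , AND (SI d-AX E⊨A) d
    , inj₁ (λ _ → ∧-trueˡ) ∷ All.map (Sum.map₁ λ D⊨X′ v → D⊨X′ v ∘ ∧-trueʳ) cls
  ... | D , d , cls | no ¬E⊨A = D , d , inj₂ ¬E⊨A ∷ cls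

  saturate : HasCT k → (B : Form) (S : List IOPair) → All (G ⊢[ k ]_) S
           → ∃ λ D → G ⊢[ k ] (B , D) × All (λ h → D ⊨ proj₂ h ⊎ ¬ ((B ∧' D) ⊨ proj₁ h)) S
  saturate ct B S ds = go S (<-wellFounded (length S)) ds ⊤' ⊢-⊤ (All.tabulate inj₂)
    where
    go : (R : List IOPair) → Acc _<_ (length R) → All (G ⊢[ k ]_) R → (D : Form) → G ⊢[ k ] (B , D)
       → All (λ h → D ⊨ proj₂ h ⊎ h ∈ R) S
       → ∃ λ D → G ⊢[ k ] (B , D) × All (λ h → D ⊨ proj₂ h ⊎ ¬ ((B ∧' D) ⊨ proj₁ h)) S
    go R (acc smaller) dR D d pending with any? (λ h → (B ∧' D) ⊨? proj₁ h) R
    ... | no none = D , d , All.map (Sum.map₂ (All.lookup (¬Any⇒All¬ R none))) pending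
    ... | yes fires =
      go (R ─ fires) (smaller shorter) (─⁺ fires dR)
         (D ∧' X) (AND d (CT ct d (SI d-fired BD⊨A))) (All.map update pending)
      where
      X : Form
      X = proj₂ (Any.lookup fires)
      d-fired : G ⊢[ k ] Any.lookup fires
      d-fired = proj₁ (All.lookupAny dR fires)
      BD⊨A : (B ∧' D) ⊨ proj₁ (Any.lookup fires)
      BD⊨A = proj₂ (All.lookupAny dR fires)
      shorter : length (R ─ fires) < length R
      shorter = ≤-reflexive (sym (length-removeAt′ R (Any.index fires)))
      update : ∀ {h} → D ⊨ proj₂ h ⊎ h ∈ R → (D ∧' X) ⊨ proj₂ h ⊎ h ∈ (R ─ fires)
      update (inj₁ D⊨X′) = inj₁ λ v → D⊨X′ v ∘ ∧-trueˡ
      update (inj₂ h∈R) = Sum.map₁ (λ { refl _ → ∧-trueʳ }) (∈-─ fires h∈R)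

countermodel-from-levels : ∀ {L N} G B Y D (vs : ℕ → Valuation) → L 0
  → (∀ j → j < N → ⟦ B ⟧ (vs (suc j)) ≡ true) → ⟦ Y ⟧ (vs 0) ≡ false
  → (∀ l → L l → ⟦ D ⟧ (vs l) ≡ true)
  → All (λ h → D ⊨ proj₂ h ⊎ ∃ λ j → j < N × ⟦ proj₁ h ⟧ (vs (suc j)) ≡ false) G
  → Countermodel (Valid L N) G (B , Y)
countermodel-from-levels {L} {N} G B Y D vs L0 B-premise Y-false D-output cls =
  stack vs , (λ valid → not-¬ (valid B-premise 0 L0) Y-false) , All.map (λ {h} → valid {h}) cls
  where
  valid : ∀ {h} → D ⊨ proj₂ h ⊎ (∃ λ j → j < N × ⟦ proj₁ h ⟧ (vs (suc j)) ≡ false)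
        → Valid L N (stack vs) h
  valid (inj₁ D⊨X) _ l Ll = D⊨X (vs l) (D-output l Ll)
  valid (inj₂ (j , j<N , A-false)) premise = ⊥-elim (not-¬ (premise j j<N) A-false)

module Falsifiers (E : Form) (u : Valuation) (Eu : ⟦ E ⟧ u ≡ true) where

  falsifier : ∀ A → ∃ λ w → ⟦ E ⟧ w ≡ true × (¬ (E ⊨ A) → ⟦ A ⟧ w ≡ false)
  falsifier A with entails-or-refutes E A
  ... | inj₁ E⊨A = u , Eu , contradiction E⊨A
  ... | inj₂ (w , Ew , Aw) = w , Ew , λ _ → Aw

  falsifiers : List IOPair → ℕ → Valuation
  falsifiers [] _ = u
  falsifiers (h ∷ _) zero = proj₁ (falsifier (proj₁ h))
  falsifiers (_ ∷ S) (suc j) = falsifiers S j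

  falsifiers-model : ∀ S j → ⟦ E ⟧ (falsifiers S j) ≡ true
  falsifiers-model [] _ = Eu
  falsifiers-model (h ∷ _) zero = proj₁ (proj₂ (falsifier (proj₁ h)))
  falsifiers-model (_ ∷ S) (suc j) = falsifiers-model S j

  falsify : ∀ {Q : IOPair → Set} S → All (λ h → Q h ⊎ ¬ (E ⊨ proj₁ h)) S
          → All (λ h → Q h ⊎ ∃ λ j → j < length S × ⟦ proj₁ h ⟧ (falsifiers S j) ≡ false) S
  falsify [] [] = []
  falsify (h ∷ S) (c ∷ cs) =
    Sum.map₂ (λ ¬E⊨A → 0 , z<s , proj₂ (proj₂ (falsifier (proj₁ h))) ¬E⊨A) c
    ∷ All.map (Sum.map₂ λ { (j , j<n , A-false) → suc j , s≤s j<n , A-false }) (falsify S cs)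

-- Level j+1 holds a model of E falsifying the input of the j-th pair when E does not entail it.
spread-countermodel : ∀ {L} G B Y E D → L 0 → E ⊨ B → (∀ j → L (suc j) → E ⊨ D)
  → (∃ λ u → ⟦ E ⟧ u ≡ true) → D ⊭ Y
  → All (λ h → D ⊨ proj₂ h ⊎ ¬ (E ⊨ proj₁ h)) G
  → Countermodel (Valid L (suc (length G))) G (B , Y)
spread-countermodel {L} G B Y E D L0 E⊨B E⊨D (u , Eu) (w , Dw , Yw) cls =
  countermodel-from-levels G B Y D vs L0 (λ j _ → E⊨B _ (falsifiers-model G j)) Yw D-output
    (All.map (Sum.map₂ λ { (j , j<n , A-false) → j , m<n⇒m<1+n j<n , A-false }) (falsify G cls))
  where
  open Falsifiers E u Eu
  vs : ℕ → Valuation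
  vs zero = w
  vs (suc j) = falsifiers G j
  D-output : ∀ l → L l → ⟦ D ⟧ (vs l) ≡ true
  D-output zero _ = Dw
  D-output (suc j) Lsj = E⊨D j Lsj _ (falsifiers-model G j)

Decides : Form → Form → Set
Decides C A = C ⊨ A ⊎ C ⊨ (¬' A)

⊨-cases : ∀ C A → C ⊨ ((C ∧' A) ∨' (C ∧' ¬' A))
⊨-cases C A v c rewrite c = ∨-inverseʳ (⟦ A ⟧ v)

-- As C decides every input, one model of C at level 1 falsifies all inputs that C does not entail.
uniform-countermodel : ∀ {L} G B Y C D → L 0 → C ⊨ B → All (Decides C ∘ proj₁) G
  → (u : Valuation) → ⟦ C ⟧ u ≡ true → (∀ j → L (suc j) → ⟦ D ⟧ u ≡ true) → D ⊭ Y
  → All (λ h → D ⊨ proj₂ h ⊎ ¬ (C ⊨ proj₁ h)) G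
  → Countermodel (Valid L 1) G (B , Y)
uniform-countermodel {L} G B Y C D L0 C⊨B decides u Cu Du (w , Dw , Yw) cls =
  countermodel-from-levels G B Y D vs L0 B-premise Yw D-output
    (All.zipWith (λ {h} → refine {h}) (decides , cls))
  where
  vs : ℕ → Valuation
  vs zero = w
  vs (suc _) = u
  B-premise : ∀ j → j < 1 → ⟦ B ⟧ (vs (suc j)) ≡ true
  B-premise zero _ = C⊨B u Cu
  B-premise (suc _) (s≤s ())
  D-output : ∀ l → L l → ⟦ D ⟧ (vs l) ≡ true
  D-output zero _ = Dw
  D-output (suc j) = Du j
  refine : ∀ {h} → Decides C (proj₁ h) × (D ⊨ proj₂ h ⊎ ¬ (C ⊨ proj₁ h))
         → D ⊨ proj₂ h ⊎ ∃ λ j → j < 1 × ⟦ proj₁ h ⟧ (vs (suc j)) ≡ false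
  refine (_ , inj₁ D⊨X) = inj₁ D⊨X
  refine (inj₁ C⊨A , inj₂ ¬C⊨A) = contradiction C⊨A ¬C⊨A
  refine (inj₂ C⊨¬A , inj₂ _) = inj₂ (0 , z<s , not-true (C⊨¬A u Cu))

shannon : ∀ {G k Y} {R : Set} → HasOR k → (As : List Form) (C : Form)
        → (∀ C′ → C′ ⊨ C → All (Decides C′) As → G ⊢[ k ] (C′ , Y) ⊎ R)
        → G ⊢[ k ] (C , Y) ⊎ R
shannon or [] C cell = cell C (λ _ c → c) []
shannon {G} {k} {Y} {R} or (A ∷ As) C cell =
  combine (restrict (C ∧' A) (inj₁ (λ _ → ∧-trueʳ)) (λ _ → ∧-trueˡ))
          (restrict (C ∧' ¬' A) (inj₂ (λ _ → ∧-trueʳ)) (λ _ → ∧-trueˡ))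
  where
  restrict : ∀ C₀ → Decides C₀ A → C₀ ⊨ C → G ⊢[ k ] (C₀ , Y) ⊎ R
  restrict C₀ decides C₀⊨C = shannon or As C₀ λ C′ C′⊨C₀ ds →
    let via : ∀ F → C₀ ⊨ F → C′ ⊨ F
        via F C₀⊨F v = C₀⊨F v ∘ C′⊨C₀ v
    in cell C′ (via C C₀⊨C) (Sum.map (via A) (via (¬' A)) decides ∷ ds)
  combine : G ⊢[ k ] (C ∧' A , Y) ⊎ R → G ⊢[ k ] (C ∧' ¬' A , Y) ⊎ R → G ⊢[ k ] (C , Y) ⊎ R
  combine (inj₁ d₊) (inj₁ d₋) = inj₁ (SI (OR or d₊ d₋) (⊨-cases C A))
  combine (inj₂ r) _ = inj₂ r
  combine (inj₁ _) (inj₂ r) = inj₂ r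

leaves : ∀ {G k} → All (G ⊢[ k ]_) G
leaves = All.tabulate leaf

weaken-or-refute : ∀ {G k E D Y} {R : Set} → G ⊢[ k ] (E , D) → (D ⊭ Y → R) → G ⊢[ k ] (E , Y) ⊎ R
weaken-or-refute {D = D} {Y} d refute = Sum.map (WO d) refute (entails-or-refutes D Y)

complete₁ : ∀ G BY → G ⊢[ 1 ] BY ⊎ Countermodel (Valid (_≡ 0) (suc (length G))) G BY
complete₁ G (B , Y) with closure B G leaves | sat? B
... | _ | inj₂ B⊨⊥ = inj₁ (⊢-explode B⊨⊥)
... | D , d , cls | inj₁ model = weaken-or-refute d λ D⊭Y →
  spread-countermodel G B Y B D refl (λ _ b → b) (λ _ ()) model D⊭Y cls

complete₃ : ∀ G BY → G ⊢[ 3 ] BY ⊎ Countermodel (Valid (_< suc (suc (length G))) (suc (length G))) G BY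
complete₃ G (B , Y) with saturate (inj₁ refl) B G leaves
... | D , d , cls with sat? (B ∧' D)
...   | inj₂ BD⊨⊥ = inj₁ (CT (inj₁ refl) d (⊢-explode BD⊨⊥))
...   | inj₁ model = weaken-or-refute d λ D⊭Y →
  spread-countermodel G B Y (B ∧' D) D z<s (λ _ → ∧-trueˡ) (λ _ _ _ → ∧-trueʳ) model D⊭Y cls

complete₂ : ∀ G BY → G ⊢[ 2 ] BY ⊎ Countermodel (Valid (_≡ 0) 1) G BY
complete₂ G (B , Y) = shannon (inj₁ refl) (map proj₁ G) B cell
  where
  cell : ∀ C → C ⊨ B → All (Decides C) (map proj₁ G)
       → G ⊢[ 2 ] (C , Y) ⊎ Countermodel (Valid (_≡ 0) 1) G (B , Y)
  cell C C⊨B decides with closure C G leaves | sat? C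
  ... | _ | inj₂ C⊨⊥ = inj₁ (⊢-explode C⊨⊥)
  ... | D , d , cls | inj₁ (u , Cu) = weaken-or-refute d λ D⊭Y →
    uniform-countermodel G B Y C D refl C⊨B (map⁻ decides) u Cu (λ _ ()) D⊭Y cls

complete₄ : ∀ G BY → G ⊢[ 4 ] BY ⊎ Countermodel (Valid (_< 2) 1) G BY
complete₄ G (B , Y) = shannon (inj₂ refl) (map proj₁ G) B cell
  where
  cell : ∀ C → C ⊨ B → All (Decides C) (map proj₁ G)
       → G ⊢[ 4 ] (C , Y) ⊎ Countermodel (Valid (_< 2) 1) G (B , Y)
  cell C C⊨B decides with closure C G leaves
  ... | D , d , cls with sat? (C ∧' D)
  ...   | inj₂ CD⊨⊥ = inj₁ (CT (inj₂ refl) d (⊢-explode CD⊨⊥))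
  ...   | inj₁ (u , CDu) = weaken-or-refute d λ D⊭Y →
    uniform-countermodel G B Y C D z<s C⊨B (map⁻ decides) u (∧-trueˡ CDu) (λ _ _ → ∧-trueʳ CDu) D⊭Y cls

lemma8 : (k : ℕ) → 1 ≤ k → k ≤ 4 → (G : List IOPair) → (BY : IOPair)
       → (G ⊢[ k ] BY) ⇔ Unsatisfiable (translation k G BY)
lemma8 1 _ _ G BY = derivable⇔unsatisfiable G BY (Valid (_≡ 0) (suc (length G)))
  (λ v h → ⟦T₁₂⟧ (suc (length G)) h v)
  (λ v → Valid-closed z<s (λ { (inj₁ ()) ; (inj₂ ()) }) (λ { (inj₁ ()) ; (inj₂ ()) }))
  (complete₁ G BY)
lemma8 2 _ _ G BY = derivable⇔unsatisfiable G BY (Valid (_≡ 0) 1)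
  (λ v h → ⟦T₁₂⟧ 1 h v)
  (λ v → Valid-closed z<s (λ _ → refl) (λ { (inj₁ ()) ; (inj₂ ()) }))
  (complete₂ G BY)
lemma8 3 _ _ G BY = derivable⇔unsatisfiable G BY (Valid (_< suc (suc (length G))) (suc (length G)))
  (λ v h → ⟦T₃₄⟧ (suc (length G)) h v)
  (λ v → Valid-closed z<s (λ { (inj₁ ()) ; (inj₂ ()) }) (λ _ _ → s≤s))
  (complete₃ G BY)
lemma8 4 _ _ G BY = derivable⇔unsatisfiable G BY (Valid (_< 2) 1)
  (λ v h → ⟦T₃₄⟧ 1 h v)
  (λ v → Valid-closed z<s (λ _ → refl) (λ _ _ → s≤s))
  (complete₄ G BY)
lemma8 (suc (suc (suc (suc (suc _))))) _ (s≤s (s≤s (s≤s (s≤s ())))) _ _
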